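{- Let $k$, $n$, $r$ be positive integers with $n\ge 2r$. Then $\gamma_{\times k,t}(n,r)=k+r$ if and only if $n\ge r(k+r)$. Moreover, for any $n\ge r(k+r)$, every $k$-tuple total dominating set of $K(n,r)$ of cardinality $\gamma_{\times k,t}(n,r)$ is a clique (i.e. consists of pairwise disjoint $r$-sets).
   Context: For integers $n\ge 2r\ge 2$, the Kneser graph $K(n,r)$ has as vertices the $r$-element subsets of $[n]=\{1,\dots,n\}$, two vertices being adjacent iff they are disjoint. For a graph $G$ and positive integer $k$, a set $D\subseteq V(G)$ is a $k$-tuple total dominating set if $|N_G(u)\cap D|\ge k$ for every vertex $u\in V(G)$ ($N_G(u)$ the open neighborhood). The $k$-tuple total domination number $\gamma_{\times k,t}(G)$ is the minimum cardinality of such a set (defined when such a set exists). Write $\gamma_{\times k,t}(n,r)=\gamma_{\times k,t}(K(n,r))$. -}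

module Defs where

open import Data.Nat using (ℕ; _≤_; _≟_)
open import Data.Fin.Subset using (Subset; _∩_; ∣_∣)
open import Data.List using (List; length; filter)
open import Data.List.Relation.Unary.All using (All)
open import Data.List.Relation.Unary.AllPairs using (AllPairs)
open import Data.List.Relation.Unary.Unique.Propositional using (Unique)
open import Data.Product using (Σ; _×_)
open import Relation.Binary.PropositionalEquality using (_≡_)

IsVertex : (n r : ℕ) → Subset n → Set
IsVertex n r s = ∣ s ∣ ≡ r

Adj : {n : ℕ} → Subset n → Subset n → Set
Adj u v = ∣ u ∩ v ∣ ≡ 0

IsVertexSet : (n r : ℕ) → List (Subset n) → Set
IsVertexSet n r D = Unique D × All (IsVertex n r) D

nbrCount : {n : ℕ} → Subset n → List (Subset n) → ℕ
nbrCount u D = length (filter (λ v → ∣ u ∩ v ∣ ≟ 0) D)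

IsKTDS : (n r k : ℕ) → List (Subset n) → Set
IsKTDS n r k D =
  IsVertexSet n r D ×
  ((u : Subset n) → IsVertex n r u → k ≤ nbrCount u D)

GammaIs : (n r k m : ℕ) → Set
GammaIs n r k m =
  Σ (List (Subset n)) (λ D → IsKTDS n r k D × length D ≡ m) ×
  ((D : List (Subset n)) → IsKTDS n r k D → m ≤ length D)

IsClique : {n : ℕ} → List (Subset n) → Set
IsClique D = AllPairs Adj D

{-# OPTIONS --safe #-}
module Submission where

-- For a k-tuple total dominating set D of K(n,r) and a set S of at most r points, let
-- N(S) be the number of members of D disjoint from S.  Then k + r ≤ |S| + N(S): if
-- |S| < r, enlarge S to an r-set u, take a member A of D disjoint from u and a point
-- x ∈ A; adding x to S raises |S| by one and lowers N(S) by at least one (A is lost).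
-- With S = ∅ this gives |D| ≥ k + r.  If two members of D share a point x, S = {x}
-- gives |D| ≥ k + r + 1, so dominating sets of size k + r are cliques, and k + r
-- pairwise disjoint r-sets fit into [n] only if n ≥ r(k + r).  Conversely, such a
-- clique is k-tuple totally dominating, since an r-set meets at most r of its members.

open import Defs
open import Data.Bool using (false; true)
open import Data.Vec using ([]; _∷_; there)
open import Data.Nat using (ℕ; zero; suc; _+_; _*_; _∸_; _≤_; _<_; z≤n; s≤s; _≟_; _≤?_)
open import Data.Nat.Properties
open import Data.Fin.Subset
open import Data.Fin.Subset.Properties
open import Data.List using (List; []; _∷_; length; filter; map)
open import Data.Nat.ListAction using (sum)
open import Data.List.Properties using (length-filter; filter-notAll; filter-reject; length-map)
open import Data.List.Membership.Propositional using (find; lose) renaming (_∈_ to _∈ₗ_)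
open import Data.List.Relation.Unary.Any using (Any; here; there)
open import Data.List.Relation.Unary.All as All using (All; []; _∷_; all?)
import Data.List.Relation.Unary.All.Properties as All
open import Data.List.Relation.Unary.AllPairs as AllPairs using ([]; _∷_)
import Data.List.Relation.Unary.AllPairs.Properties as AllPairs
open import Data.List.Relation.Unary.Unique.Propositional using (Unique)
open import Data.Product using (Σ; ∃-syntax; _×_; _,_; proj₁; proj₂)
open import Data.Sum using (_⊎_; inj₁; inj₂)
open import Function.Base using (id)
open import Function.Bundles using (_⇔_; mk⇔)
open import Level using (Level)
open import Relation.Nullary using (¬_; Dec; yes; no; contradiction)
open import Relation.Unary using (Pred; Decidable)
open import Relation.Binary.PropositionalEquality

module _ {a p q : Level} {A : Set a} {P : Pred A p} {Q : Pred A q}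
         (P? : Decidable P) (Q? : Decidable Q) (Q⇒P : ∀ {x} → Q x → P x) where

  length-filter-mono : ∀ xs → length (filter Q? xs) ≤ length (filter P? xs)
  length-filter-mono [] = z≤n
  length-filter-mono (x ∷ xs) with Q? x | P? x
  ... | yes _  | yes _  = s≤s (length-filter-mono xs)
  ... | yes qx | no ¬px = contradiction (Q⇒P qx) ¬px
  ... | no _   | yes _  = m≤n⇒m≤1+n (length-filter-mono xs)
  ... | no _   | no _   = length-filter-mono xs

  length-filter-mono-< : ∀ xs → Any (λ x → P x × ¬ Q x) xs →
                         length (filter Q? xs) < length (filter P? xs)
  length-filter-mono-< (x ∷ xs) (here (px , ¬qx)) with Q? x | P? x
  ... | yes qx | _      = contradiction qx ¬qx
  ... | no _   | yes _  = s≤s (length-filter-mono xs)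
  ... | no _   | no ¬px = contradiction px ¬px
  length-filter-mono-< (x ∷ xs) (there any) with Q? x | P? x
  ... | yes _  | yes _  = s≤s (length-filter-mono-< xs any)
  ... | yes qx | no ¬px = contradiction (Q⇒P qx) ¬px
  ... | no _   | yes _  = m≤n⇒m≤1+n (length-filter-mono-< xs any)
  ... | no _   | no _   = length-filter-mono-< xs any

module _ {a p} {A : Set a} {P : Pred A p} (P? : Decidable P) where

  filter-some⁻ : ∀ xs → 0 < length (filter P? xs) → Any P xs
  filter-some⁻ (x ∷ xs) positive with P? x
  ... | yes px = here px
  ... | no _   = there (filter-some⁻ xs positive)

  length-filter-∷ : ∀ x xs → length (filter P? (x ∷ xs)) ≤ suc (length (filter P? xs))
  length-filter-∷ x xs with P? x
  ... | yes _ = ≤-refl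
  ... | no _  = n≤1+n _

  length≤length-filter+∑ : (f : A → ℕ) → (∀ {x} → ¬ P x → 0 < f x) →
                           ∀ xs → length xs ≤ length (filter P? xs) + sum (map f xs)
  length≤length-filter+∑ f positive [] = z≤n
  length≤length-filter+∑ f positive (x ∷ xs) with ih ← length≤length-filter+∑ f positive xs | P? x
  ... | yes _ = s≤s (≤-trans ih (+-monoʳ-≤ (length (filter P? xs)) (m≤n+m (sum (map f xs)) (f x))))
  ... | no ¬px = begin
    suc (length xs)                          ≤⟨ s≤s ih ⟩
    suc (length (filter P? xs) + ∑)          ≡⟨ sym (+-suc _ ∑) ⟩
    length (filter P? xs) + suc ∑            ≤⟨ +-monoʳ-≤ _ (+-monoˡ-≤ ∑ (positive ¬px)) ⟩
    length (filter P? xs) + (f x + ∑)        ∎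
    where
      open ≤-Reasoning
      ∑ = sum (map f xs)

∣p∣≡0⇒Empty : ∀ {n} {p : Subset n} → ∣ p ∣ ≡ 0 → Empty p
∣p∣≡0⇒Empty {p = true ∷ _} ()
∣p∣≡0⇒Empty {p = false ∷ _} ∣p∣≡0 (_ , there x∈p) = ∣p∣≡0⇒Empty ∣p∣≡0 (_ , x∈p)

Empty⇒∣p∣≡0 : ∀ {n} {p : Subset n} → Empty p → ∣ p ∣ ≡ 0
Empty⇒∣p∣≡0 {n} empty = trans (cong ∣_∣ (Empty-unique empty)) (∣⊥∣≡0 n)

0<∣p∣⇒Nonempty : ∀ {n} {p : Subset n} → 0 < ∣ p ∣ → Nonempty p
0<∣p∣⇒Nonempty {p = p} 0<∣p∣ with nonempty? p
... | yes nonempty = nonempty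
... | no empty     = contradiction (Empty⇒∣p∣≡0 empty) (>⇒≢ 0<∣p∣)

∣p∪q∣+∣p∩q∣≡∣p∣+∣q∣ : ∀ {n} (p q : Subset n) → ∣ p ∪ q ∣ + ∣ p ∩ q ∣ ≡ ∣ p ∣ + ∣ q ∣
∣p∪q∣+∣p∩q∣≡∣p∣+∣q∣ []          []          = refl
∣p∪q∣+∣p∩q∣≡∣p∣+∣q∣ (true ∷ p)  (true ∷ q)  =
  cong suc (trans (+-suc ∣ p ∪ q ∣ ∣ p ∩ q ∣)
                  (trans (cong suc (∣p∪q∣+∣p∩q∣≡∣p∣+∣q∣ p q)) (sym (+-suc ∣ p ∣ ∣ q ∣))))
∣p∪q∣+∣p∩q∣≡∣p∣+∣q∣ (true ∷ p)  (false ∷ q) = cong suc (∣p∪q∣+∣p∩q∣≡∣p∣+∣q∣ p q)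
∣p∪q∣+∣p∩q∣≡∣p∣+∣q∣ (false ∷ p) (true ∷ q)  =
  trans (cong suc (∣p∪q∣+∣p∩q∣≡∣p∣+∣q∣ p q)) (sym (+-suc ∣ p ∣ ∣ q ∣))
∣p∪q∣+∣p∩q∣≡∣p∣+∣q∣ (false ∷ p) (false ∷ q) = ∣p∪q∣+∣p∩q∣≡∣p∣+∣q∣ p q

∣p∪q∣≤∣p∣+∣q∣ : ∀ {n} (p q : Subset n) → ∣ p ∪ q ∣ ≤ ∣ p ∣ + ∣ q ∣
∣p∪q∣≤∣p∣+∣q∣ p q = subst (∣ p ∪ q ∣ ≤_) (∣p∪q∣+∣p∩q∣≡∣p∣+∣q∣ p q) (m≤m+n ∣ p ∪ q ∣ ∣ p ∩ q ∣)

⊆-extend : ∀ {n r} (p : Subset n) → ∣ p ∣ ≤ r → r ≤ n → ∃[ q ] p ⊆ q × ∣ q ∣ ≡ r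
⊆-extend [] z≤n z≤n = [] , (λ ()) , refl
⊆-extend (true ∷ p) (s≤s ∣p∣≤r) (s≤s r≤n) =
  let q , p⊆q , ∣q∣≡r = ⊆-extend p ∣p∣≤r r≤n in true ∷ q , s⊆s p⊆q , cong suc ∣q∣≡r
⊆-extend {suc n} {r} (false ∷ p) ∣p∣≤r r≤1+n with r ≤? n
... | yes r≤n = let q , p⊆q , ∣q∣≡r = ⊆-extend p ∣p∣≤r r≤n in false ∷ q , out⊆ p⊆q , ∣q∣≡r
... | no r≰n  = ⊤ , ⊆⊤ , trans (∣⊤∣≡n (suc n)) (≤-antisym (≰⇒> r≰n) r≤1+n)

module _ {n : ℕ} where

  Adj? : (u v : Subset n) → Dec (Adj u v)
  Adj? u v = ∣ u ∩ v ∣ ≟ 0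

  Adj-antimono : {p p′ q q′ : Subset n} → p ⊆ p′ → q ⊆ q′ → Adj p′ q′ → Adj p q
  Adj-antimono {p} {p′} {q} {q′} p⊆p′ q⊆q′ adj = n≤0⇒n≡0 (begin
    ∣ p ∩ q ∣    ≤⟨ p⊆q⇒∣p∣≤∣q∣ p∩q⊆p′∩q′ ⟩
    ∣ p′ ∩ q′ ∣  ≡⟨ adj ⟩
    0            ∎)
    where
      open ≤-Reasoning
      p∩q⊆p′∩q′ : p ∩ q ⊆ p′ ∩ q′
      p∩q⊆p′∩q′ x∈p∩q = let x∈p , x∈q = x∈p∩q⁻ p q x∈p∩q in x∈p∩q⁺ (p⊆p′ x∈p , q⊆q′ x∈q)

  Adj⇒∉ : ∀ {p q : Subset n} {x} → Adj p q → x ∈ p → x ∉ q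
  Adj⇒∉ adj x∈p x∈q = ∣p∣≡0⇒Empty adj (_ , x∈p∩q⁺ (x∈p , x∈q))

  ¬Adj⇒Nonempty : {p q : Subset n} → ¬ Adj p q → Nonempty (p ∩ q)
  ¬Adj⇒Nonempty ¬adj = 0<∣p∣⇒Nonempty (n≢0⇒n>0 ¬adj)

  Adj⇒∣p∪q∣≡∣p∣+∣q∣ : (p q : Subset n) → Adj p q → ∣ p ∪ q ∣ ≡ ∣ p ∣ + ∣ q ∣
  Adj⇒∣p∪q∣≡∣p∣+∣q∣ p q adj =
    trans (sym (+-identityʳ _)) (trans (cong (∣ p ∪ q ∣ +_) (sym adj)) (∣p∪q∣+∣p∩q∣≡∣p∣+∣q∣ p q))

  ∉⇒∣p∪⁅x⁆∣≡1+∣p∣ : ∀ {p : Subset n} {x} → x ∉ p → ∣ p ∪ ⁅ x ⁆ ∣ ≡ suc ∣ p ∣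
  ∉⇒∣p∪⁅x⁆∣≡1+∣p∣ {p} {x} x∉p = begin
    ∣ p ∪ ⁅ x ⁆ ∣      ≡⟨ Adj⇒∣p∪q∣≡∣p∣+∣q∣ p ⁅ x ⁆ p#⁅x⁆ ⟩
    ∣ p ∣ + ∣ ⁅ x ⁆ ∣  ≡⟨ cong (∣ p ∣ +_) (∣⁅x⁆∣≡1 x) ⟩
    ∣ p ∣ + 1          ≡⟨ +-comm ∣ p ∣ 1 ⟩
    suc ∣ p ∣          ∎
    where
      open ≡-Reasoning
      p#⁅x⁆ : Adj p ⁅ x ⁆
      p#⁅x⁆ = Empty⇒∣p∣≡0 λ (y , y∈p∩⁅x⁆) →
        let y∈p , y∈⁅x⁆ = x∈p∩q⁻ p ⁅ x ⁆ y∈p∩⁅x⁆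
        in x∉p (subst (_∈ p) (x∈⁅y⁆⇒x≡y x y∈⁅x⁆) y∈p)

  Adj-⋃ : ∀ {p : Subset n} {D : List (Subset n)} → All (Adj p) D → Adj p (⋃ D)
  Adj-⋃ {p} [] = trans (cong ∣_∣ (∩-zeroʳ p)) (∣⊥∣≡0 n)
  Adj-⋃ {p} {A ∷ D} (p#A ∷ p#D) = n≤0⇒n≡0 (begin
    ∣ p ∩ (A ∪ ⋃ D) ∣        ≡⟨ cong ∣_∣ (∩-distribˡ-∪ p A (⋃ D)) ⟩
    ∣ (p ∩ A) ∪ (p ∩ ⋃ D) ∣  ≤⟨ ∣p∪q∣≤∣p∣+∣q∣ (p ∩ A) (p ∩ ⋃ D) ⟩
    ∣ p ∩ A ∣ + ∣ p ∩ ⋃ D ∣  ≡⟨ cong₂ _+_ p#A (Adj-⋃ {p} p#D) ⟩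
    0                        ∎)
    where open ≤-Reasoning

  nbrCount-antimono-< : ∀ {S S′ : Subset n} {A} (D : List (Subset n)) → S ⊆ S′ →
                        A ∈ₗ D → Adj S A → ¬ Adj S′ A → nbrCount S′ D < nbrCount S D
  nbrCount-antimono-< {S} {S′} D S⊆S′ A∈D S#A ¬S′#A =
    length-filter-mono-< (Adj? S) (Adj? S′) (λ {B} → Adj-antimono {S} {S′} {B} {B} S⊆S′ id) D
                         (lose A∈D (S#A , ¬S′#A))

  clique⊎sharedPoint : (D : List (Subset n)) →
                       IsClique D ⊎ ∃[ x ] 2 + nbrCount ⁅ x ⁆ D ≤ length D
  clique⊎sharedPoint [] = inj₁ []
  clique⊎sharedPoint (A ∷ D) with all? (Adj? A) D
  ... | yes A#D with clique⊎sharedPoint D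
  ...   | inj₁ clique      = inj₁ (A#D ∷ clique)
  ...   | inj₂ (x , twice) = inj₂ (x , ≤-trans (+-monoʳ-≤ 2 (length-filter-∷ (Adj? ⁅ x ⁆) A D)) (s≤s twice))
  clique⊎sharedPoint (A ∷ D) | no ¬A#D =
    let B , B∈D , ¬A#B = find (All.¬All⇒Any¬ (Adj? A) D ¬A#D)
        x , x∈A∩B      = ¬Adj⇒Nonempty {A} {B} ¬A#B
        x∈A , x∈B      = x∈p∩q⁻ A B x∈A∩B
        misses : ∀ {C} → x ∈ C → ¬ Adj ⁅ x ⁆ C
        misses {C} x∈C ⁅x⁆#C = Adj⇒∉ {⁅ x ⁆} {C} ⁅x⁆#C (x∈⁅x⁆ x) x∈C
    in inj₂ (x , s≤s (begin-strict
      nbrCount ⁅ x ⁆ (A ∷ D)  ≡⟨ cong length (filter-reject (Adj? ⁅ x ⁆) (misses x∈A)) ⟩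
      nbrCount ⁅ x ⁆ D        <⟨ filter-notAll (Adj? ⁅ x ⁆) D (lose B∈D (misses x∈B)) ⟩
      length D                ∎))
    where open ≤-Reasoning

  length≤nbrCount+∑∣∩∣ : ∀ u (D : List (Subset n)) →
                         length D ≤ nbrCount u D + sum (map (λ A → ∣ u ∩ A ∣) D)
  length≤nbrCount+∑∣∩∣ u = length≤length-filter+∑ (Adj? u) (λ A → ∣ u ∩ A ∣) n≢0⇒n>0

  ∣∩⋃∣≡∑∣∩∣ : ∀ u {D : List (Subset n)} → IsClique D →
              ∣ u ∩ ⋃ D ∣ ≡ sum (map (λ A → ∣ u ∩ A ∣) D)
  ∣∩⋃∣≡∑∣∩∣ u [] = trans (cong ∣_∣ (∩-zeroʳ u)) (∣⊥∣≡0 n)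
  ∣∩⋃∣≡∑∣∩∣ u {A ∷ D} (A#D ∷ clique) = begin
    ∣ u ∩ (A ∪ ⋃ D) ∣                          ≡⟨ cong ∣_∣ (∩-distribˡ-∪ u A (⋃ D)) ⟩
    ∣ (u ∩ A) ∪ (u ∩ ⋃ D) ∣                    ≡⟨ Adj⇒∣p∪q∣≡∣p∣+∣q∣ (u ∩ A) (u ∩ ⋃ D) u∩A#u∩⋃D ⟩
    ∣ u ∩ A ∣ + ∣ u ∩ ⋃ D ∣                    ≡⟨ cong (∣ u ∩ A ∣ +_) (∣∩⋃∣≡∑∣∩∣ u clique) ⟩
    ∣ u ∩ A ∣ + sum (map (λ A → ∣ u ∩ A ∣) D)  ∎
    where
      open ≡-Reasoning
      u∩A#u∩⋃D : Adj (u ∩ A) (u ∩ ⋃ D)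
      u∩A#u∩⋃D = Adj-antimono {u ∩ A} {A} {u ∩ ⋃ D} {⋃ D} (p∩q⊆q u A) (p∩q⊆q u (⋃ D)) (Adj-⋃ {A} A#D)

  ∣⋃∣≡length*r : ∀ {r} {D : List (Subset n)} → IsClique D → All (IsVertex n r) D →
                 ∣ ⋃ D ∣ ≡ length D * r
  ∣⋃∣≡length*r [] [] = ∣⊥∣≡0 n
  ∣⋃∣≡length*r {D = A ∷ D} (A#D ∷ clique) (∣A∣≡r ∷ vertices) =
    trans (Adj⇒∣p∪q∣≡∣p∣+∣q∣ A (⋃ D) (Adj-⋃ {A} A#D)) (cong₂ _+_ ∣A∣≡r (∣⋃∣≡length*r clique vertices))

  clique⇒Unique : ∀ {r} → 1 ≤ r → {D : List (Subset n)} → IsClique D → All (IsVertex n r) D →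
                  Unique D
  clique⇒Unique 1≤r [] [] = []
  clique⇒Unique 1≤r {A ∷ D} (A#D ∷ clique) (∣A∣≡r ∷ vertices) =
    All.map (λ {B} A#B A≡B → ¬A#A (subst (Adj A) (sym A≡B) A#B)) A#D ∷ clique⇒Unique 1≤r clique vertices
    where
      ¬A#A : ¬ Adj A A
      ¬A#A A#A = >⇒≢ 1≤r (trans (sym ∣A∣≡r) (trans (cong ∣_∣ (sym (∩-idem A))) A#A))

clique⇒KTDS : ∀ {n r k} {D : List (Subset n)} → 1 ≤ r → length D ≡ k + r →
              IsClique D → All (IsVertex n r) D → IsKTDS n r k D
clique⇒KTDS {n} {r} {k} {D} 1≤r len clique vertices =
  (clique⇒Unique 1≤r clique vertices , vertices) , dominating
  where
    dominating : (u : Subset n) → IsVertex n r u → k ≤ nbrCount u D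
    dominating u ∣u∣≡r = +-cancelʳ-≤ r k (nbrCount u D) (begin
      k + r                                         ≡⟨ sym len ⟩
      length D                                      ≤⟨ length≤nbrCount+∑∣∩∣ u D ⟩
      nbrCount u D + sum (map (λ A → ∣ u ∩ A ∣) D)  ≡⟨ cong (nbrCount u D +_) (sym (∣∩⋃∣≡∑∣∩∣ u clique)) ⟩
      nbrCount u D + ∣ u ∩ ⋃ D ∣                    ≤⟨ +-monoʳ-≤ (nbrCount u D) (∣p∩q∣≤∣p∣ u (⋃ D)) ⟩
      nbrCount u D + ∣ u ∣                          ≡⟨ cong (nbrCount u D +_) ∣u∣≡r ⟩
      nbrCount u D + r                              ∎)
      where open ≤-Reasoning

module KTDS {n r k} (1≤k : 1 ≤ k) (1≤r : 1 ≤ r) (r≤n : r ≤ n)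
            {D : List (Subset n)} (D-ktds : IsKTDS n r k D) where

  private
    vertices : All (IsVertex n r) D
    vertices = proj₂ (proj₁ D-ktds)

    dominating : (u : Subset n) → IsVertex n r u → k ≤ nbrCount u D
    dominating = proj₂ D-ktds

  grow : ∀ S → ∣ S ∣ < r → ∃[ x ] x ∉ S × nbrCount (S ∪ ⁅ x ⁆) D < nbrCount S D
  grow S ∣S∣<r =
    let u , S⊆u , ∣u∣≡r = ⊆-extend S (<⇒≤ ∣S∣<r) r≤n
        A , A∈D , u#A   = find (filter-some⁻ (Adj? u) D (≤-trans 1≤k (dominating u ∣u∣≡r)))
        x , x∈A         = 0<∣p∣⇒Nonempty (subst (0 <_) (sym (All.lookup vertices A∈D)) 1≤r)
        S#A             = Adj-antimono {p = S} {u} {A} {A} S⊆u id u#A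
        ¬S∪⁅x⁆#A : ¬ Adj (S ∪ ⁅ x ⁆) A
        ¬S∪⁅x⁆#A S∪⁅x⁆#A = Adj⇒∉ {p = S ∪ ⁅ x ⁆} {A} S∪⁅x⁆#A (x∈p∪q⁺ (inj₂ (x∈⁅x⁆ x))) x∈A
    in x , (λ x∈S → Adj⇒∉ {p = S} {A} S#A x∈S x∈A)
         , nbrCount-antimono-< {S = S} {S ∪ ⁅ x ⁆} D (p⊆p∪q ⁅ x ⁆) A∈D S#A ¬S∪⁅x⁆#A

  k+r≤∣S∣+nbrCount : ∀ S → ∣ S ∣ ≤ r → k + r ≤ ∣ S ∣ + nbrCount S D
  k+r≤∣S∣+nbrCount S ∣S∣≤r = byDeficit (r ∸ ∣ S ∣) S (m∸n+n≡m ∣S∣≤r)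
    where
      open ≤-Reasoning
      byDeficit : ∀ j S → j + ∣ S ∣ ≡ r → k + r ≤ ∣ S ∣ + nbrCount S D
      byDeficit zero S ∣S∣≡r = begin
        k + r                 ≡⟨ +-comm k r ⟩
        r + k                 ≤⟨ +-mono-≤ (≤-reflexive (sym ∣S∣≡r)) (dominating S ∣S∣≡r) ⟩
        ∣ S ∣ + nbrCount S D  ∎
      byDeficit (suc j) S 1+j+∣S∣≡r =
        let x , x∉S , fewer = grow S (≤-trans (s≤s (m≤n+m ∣ S ∣ j)) (≤-reflexive 1+j+∣S∣≡r))
            S′ = S ∪ ⁅ x ⁆
            ∣S′∣≡1+∣S∣ = ∉⇒∣p∪⁅x⁆∣≡1+∣p∣ x∉S
        in begin
          k + r                         ≤⟨ byDeficit j S′ (trans (cong (j +_) ∣S′∣≡1+∣S∣) (trans (+-suc j ∣ S ∣) 1+j+∣S∣≡r)) ⟩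
          ∣ S′ ∣ + nbrCount S′ D        ≡⟨ cong (_+ nbrCount S′ D) ∣S′∣≡1+∣S∣ ⟩
          suc ∣ S ∣ + nbrCount S′ D     ≡⟨ sym (+-suc ∣ S ∣ (nbrCount S′ D)) ⟩
          ∣ S ∣ + suc (nbrCount S′ D)   ≤⟨ +-monoʳ-≤ ∣ S ∣ fewer ⟩
          ∣ S ∣ + nbrCount S D          ∎

  k+r≤length : k + r ≤ length D
  k+r≤length = begin
    k + r                     ≤⟨ k+r≤∣S∣+nbrCount ⊥ (≤-trans (≤-reflexive (∣⊥∣≡0 n)) z≤n) ⟩
    ∣ ⊥ {n} ∣ + nbrCount ⊥ D  ≡⟨ cong (_+ nbrCount ⊥ D) (∣⊥∣≡0 n) ⟩
    nbrCount ⊥ D              ≤⟨ length-filter (Adj? ⊥) D ⟩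
    length D                  ∎
    where open ≤-Reasoning

  length≤k+r⇒IsClique : length D ≤ k + r → IsClique D
  length≤k+r⇒IsClique length≤k+r with clique⊎sharedPoint D
  ... | inj₁ clique      = clique
  ... | inj₂ (x , twice) = contradiction (begin-strict
    k + r                         ≤⟨ k+r≤∣S∣+nbrCount ⁅ x ⁆ (≤-trans (≤-reflexive (∣⁅x⁆∣≡1 x)) 1≤r) ⟩
    ∣ ⁅ x ⁆ ∣ + nbrCount ⁅ x ⁆ D  ≡⟨ cong (_+ nbrCount ⁅ x ⁆ D) (∣⁅x⁆∣≡1 x) ⟩
    1 + nbrCount ⁅ x ⁆ D          <⟨ twice ⟩
    length D                      ≤⟨ length≤k+r ⟩
    k + r                         ∎) (<-irrefl refl)
    where open ≤-Reasoning

pad : ∀ r {n} → Subset n → Subset (r + n)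
pad zero    p = p
pad (suc r) p = outside ∷ pad r p

block : ∀ r n → Subset (r + n)
block zero    n = ⊥
block (suc r) n = inside ∷ block r n

∣pad∣ : ∀ r {n} (p : Subset n) → ∣ pad r p ∣ ≡ ∣ p ∣
∣pad∣ zero    p = refl
∣pad∣ (suc r) p = ∣pad∣ r p

pad-∩ : ∀ r {n} (p q : Subset n) → pad r p ∩ pad r q ≡ pad r (p ∩ q)
pad-∩ zero    p q = refl
pad-∩ (suc r) p q = cong (outside ∷_) (pad-∩ r p q)

∣block∣ : ∀ r n → ∣ block r n ∣ ≡ r
∣block∣ zero    n = ∣⊥∣≡0 n
∣block∣ (suc r) n = cong suc (∣block∣ r n)

Adj-block-pad : ∀ r {n} (p : Subset n) → Adj (block r n) (pad r p)
Adj-block-pad zero    {n} p = trans (cong ∣_∣ (∩-zeroˡ p)) (∣⊥∣≡0 n)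
Adj-block-pad (suc r)     p = Adj-block-pad r p

Adj-pad : ∀ r {n} {p q : Subset n} → Adj p q → Adj (pad r p) (pad r q)
Adj-pad r {p = p} {q} p#q = trans (cong ∣_∣ (pad-∩ r p q)) (trans (∣pad∣ r (p ∩ q)) p#q)

KneserClique : (n r m : ℕ) → Set
KneserClique n r m = Σ (List (Subset n)) λ D → length D ≡ m × IsClique D × All (IsVertex n r) D

KneserClique-suc : ∀ {n r m} → KneserClique n r m → KneserClique (r + n) r (suc m)
KneserClique-suc {n} {r} (D , len , clique , vertices) =
  block r n ∷ map (pad r) D ,
  cong suc (trans (length-map (pad r) D) len) ,
  All.map⁺ (All.universal (Adj-block-pad r) D) ∷ AllPairs.map⁺ (AllPairs.map (Adj-pad r) clique) ,
  ∣block∣ r n ∷ All.map⁺ (All.map (λ {p} ∣p∣≡r → trans (∣pad∣ r p) ∣p∣≡r) vertices)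

kneserClique : ∀ r m n → m * r ≤ n → KneserClique n r m
kneserClique r zero    n _      = [] , refl , [] , []
kneserClique r (suc m) n r+mr≤n =
  subst (λ n → KneserClique n r (suc m)) (m+[n∸m]≡n r≤n)
        (KneserClique-suc (kneserClique r m (n ∸ r) mr≤n∸r))
  where
    r≤n : r ≤ n
    r≤n = ≤-trans (m≤m+n r (m * r)) r+mr≤n
    mr≤n∸r : m * r ≤ n ∸ r
    mr≤n∸r = m+n≤o⇒m≤o∸n (m * r) (≤-trans (≤-reflexive (+-comm (m * r) r)) r+mr≤n)

mainTheorem4 : (k n r : ℕ) → 1 ≤ k → 1 ≤ r → 2 * r ≤ n →
    (GammaIs n r k (k + r) ⇔ r * (k + r) ≤ n) ×
    (r * (k + r) ≤ n → (m : ℕ) → GammaIs n r k m →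
      (D : List (Subset n)) → IsKTDS n r k D → length D ≡ m → IsClique D)
mainTheorem4 k n r 1≤k 1≤r 2r≤n = mk⇔ γ≡k+r⇒r[k+r]≤n r[k+r]≤n⇒γ≡k+r , minimum⇒IsClique
  where
    open ≤-Reasoning
    module K = KTDS 1≤k 1≤r (≤-trans (m≤m+n r (r + 0)) 2r≤n)

    r[k+r]≤n⇒γ≡k+r : r * (k + r) ≤ n → GammaIs n r k (k + r)
    r[k+r]≤n⇒γ≡k+r r[k+r]≤n =
      let D , len , clique , vertices = kneserClique r (k + r) n (subst (_≤ n) (*-comm r (k + r)) r[k+r]≤n)
      in (D , clique⇒KTDS 1≤r len clique vertices , len) , λ _ → K.k+r≤length

    γ≡k+r⇒r[k+r]≤n : GammaIs n r k (k + r) → r * (k + r) ≤ n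
    γ≡k+r⇒r[k+r]≤n ((D , D-ktds , len) , _) = begin
      r * (k + r)   ≡⟨ *-comm r (k + r) ⟩
      (k + r) * r   ≡⟨ cong (_* r) len ⟨
      length D * r  ≡⟨ ∣⋃∣≡length*r (K.length≤k+r⇒IsClique D-ktds (≤-reflexive len)) (proj₂ (proj₁ D-ktds)) ⟨
      ∣ ⋃ D ∣       ≤⟨ ∣p∣≤n (⋃ D) ⟩
      n             ∎

    minimum⇒IsClique : r * (k + r) ≤ n → (m : ℕ) → GammaIs n r k m →
      (D : List (Subset n)) → IsKTDS n r k D → length D ≡ m → IsClique D
    minimum⇒IsClique r[k+r]≤n m (_ , minimal) D D-ktds len =
      let (D₀ , D₀-ktds , len₀) , _ = r[k+r]≤n⇒γ≡k+r r[k+r]≤n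
      in K.length≤k+r⇒IsClique D-ktds (begin
        length D   ≡⟨ len ⟩
        m          ≤⟨ minimal D₀ D₀-ktds ⟩
        length D₀  ≡⟨ len₀ ⟩
        k + r      ∎)
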